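{- If $(H_{\mathbf{k}})$, $\mathbf{k}\in\mathbb{N}^h$, is a polynomial (respectively strongly polynomial) sequence of graphs, each of which is a simple graph with a single loop added on each vertex, then the sequence of graphs obtained by removing all loops from the graphs $H_{\mathbf{k}}$ is polynomial (respectively strongly polynomial).
   Context: Graphs are finite; $\mathrm{hom}(G,H)$ counts homomorphisms. $\mathbb{N}$ denotes the positive integers. A sequence $(H_{\mathbf{k}})$ indexed by all $\mathbf{k}\in\mathbb{N}^h$ is polynomial if for every graph $G$ there are finitely many polynomials $p_1(G;\mathbf{x}),\dots,p_m(G;\mathbf{x})$ such that for every $\mathbf{k}$, $\mathrm{hom}(G,H_{\mathbf{k}})=p_\ell(G;\mathbf{k})$ for some $\ell$; it is strongly polynomial if a single polynomial works for all $\mathbf{k}$. -}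

module Defs where

open import Data.Nat using (ℕ; zero; suc; _^_; _≤_)
open import Data.Fin using (Fin; zero; suc; _≟_)
open import Data.Bool using (Bool; true; false; _∧_; _∨_; not; if_then_else_)
open import Data.List using (List; []; _∷_; [_]; map; concatMap; allFin)
open import Data.Nat.ListAction using (sum; product)
open import Data.Bool.ListAction using (and)
open import Data.List.Relation.Unary.Any using (Any)
open import Data.Product using (Σ; _×_)
open import Data.Integer using (+_)
open import Data.Rational using (ℚ; _/_; _+_; _*_; 0ℚ)
open import Relation.Nullary.Decidable using (⌊_⌋)
open import Relation.Binary.PropositionalEquality using (_≡_)

-- A finite graph on vertex set Fin size, given by a symmetric adjacency
-- relation; loops (adj i i ≡ true) are allowed, multiple edges are not.
record Graph : Set where
  field
    size : ℕ
    adj  : Fin size → Fin size → Bool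
    adj-sym : ∀ i j → adj i j ≡ adj j i
open Graph public

consF : ∀ {n m} → Fin m → (Fin n → Fin m) → Fin (suc n) → Fin m
consF x f zero = x
consF x f (suc i) = f i

allMaps : (n m : ℕ) → List (Fin n → Fin m)
allMaps zero m = [ (λ ()) ]
allMaps (suc n) m = concatMap (λ f → map (λ x → consF x f) (allFin m)) (allMaps n m)

isHom : (G H : Graph) → (Fin (size G) → Fin (size H)) → Bool
isHom G H f =
  and (map (λ i → and (map (λ j → not (adj G i j) ∨ adj H (f i) (f j))
                           (allFin (size G))))
           (allFin (size G)))

hom : Graph → Graph → ℕ
hom G H = sum (map (λ f → if isHom G H f then 1 else 0) (allMaps (size G) (size H)))

AllLooped : Graph → Set
AllLooped H = ∀ i → adj H i i ≡ true

removeLoops : Graph → Graph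
removeLoops H = record
  { size = size H
  ; adj = λ i j → adj H i j ∧ not ⌊ i ≟ j ⌋
  ; adj-sym = sym'
  }
  where
  open import Relation.Binary.PropositionalEquality using (cong₂; refl)
  open import Relation.Nullary using (yes; no)
  open import Relation.Binary.PropositionalEquality using (sym)
  sym' : ∀ i j → (adj H i j ∧ not ⌊ i ≟ j ⌋) ≡ (adj H j i ∧ not ⌊ j ≟ i ⌋)
  sym' i j with i ≟ j | j ≟ i
  ... | yes _ | yes _ = cong₂ _∧_ (adj-sym H i j) refl
  ... | yes p | no q = Data.Empty.⊥-elim (q (sym p)) where import Data.Empty
  ... | no q | yes p = Data.Empty.⊥-elim (q (sym p)) where import Data.Empty
  ... | no _ | no _ = cong₂ _∧_ (adj-sym H i j) refl

Index : ℕ → Set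
Index h = Fin h → ℕ

Positive : ∀ {h} → Index h → Set
Positive k = ∀ i → 1 ≤ k i

-- polynomial in h variables with rational coefficients:
-- a finite list of monomials (coefficient, exponent vector)
Poly : ℕ → Set
Poly h = List (ℚ × (Fin h → ℕ))

toℚ : ℕ → ℚ
toℚ n = + n / 1

monomial : ∀ {h} → (Fin h → ℕ) → Index h → ℕ
monomial e k = product (map (λ i → k i ^ e i) (allFin _))

eval : ∀ {h} → Poly h → Index h → ℚ
eval [] k = 0ℚ
eval ((c Data.Product., e) ∷ p) k = c * toℚ (monomial e k) + eval p k
  where import Data.Product

Sequence : ℕ → Set
Sequence h = Index h → Graph

IsPolynomial : ∀ {h} → Sequence h → Set
IsPolynomial {h} H = ∀ (G : Graph) → Σ (List (Poly h)) λ ps →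
  ∀ (k : Index h) → Positive k → Any (λ p → toℚ (hom G (H k)) ≡ eval p k) ps

IsStronglyPolynomial : ∀ {h} → Sequence h → Set
IsStronglyPolynomial {h} H = ∀ (G : Graph) → Σ (Poly h) λ p →
  ∀ (k : Index h) → Positive k → toℚ (hom G (H k)) ≡ eval p k

module Submission where

-- A homomorphism G → H° (H with its loops removed) is a map V(G) → V(H) sending edges to
-- edges of H and separating the two ends of every edge of G.  Let N(E, D) count the maps that
-- send the pairs of E to edges and separate the pairs of D.  Splitting by whether f i = f j,
--   N(E, ij ∷ D) = N(E, D) − N(E/ij, D/ij),
-- where /ij identifies i and j, and N(E, []) = hom(F_E, H) for the graph F_E with edge set E.
-- So hom(G, H°) is a rational combination of numbers hom(F, H) whose graphs F and coefficients
-- depend on G only, and fixed linear combinations of (strongly) polynomial functions of k are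
-- again (strongly) polynomial.

open import Defs
open import Data.Nat using (ℕ)
open import Data.Product using (_×_)

open import Data.Bool using (Bool; true; false; T; _∧_; _∨_; not; if_then_else_)
open import Data.Bool.ListAction using (and; all)
open import Data.Bool.Properties using (T-∧; T-∨; ∧-assoc; ∧-comm; ∧-identityʳ; ∨-comm; ∧-commutativeMonoid)
open import Data.Empty using (⊥-elim)
open import Data.Fin using (Fin; zero; suc; punchIn; punchOut; _≟_)
open import Data.Fin.Properties using (all?; punchInᵢ≢i; punchIn-punchOut; punchOut-punchIn; punchOut-cong)
open import Data.List using (List; []; _∷_; [_]; _++_; map; concatMap; allFin; length; cartesianProductWith)
import Data.List.Properties as LP
open import Data.List.Membership.Propositional using (_∈_)
open import Data.List.Membership.Propositional.Properties using (∈-allFin)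
import Data.List.Membership.DecPropositional as DecMembership
open import Data.List.Relation.Unary.All as All using ()
open import Data.List.Relation.Unary.All.Properties using (all⁺; all⁻)
open import Data.List.Relation.Unary.Any using (Any; here) renaming (map to AnyMap)
open import Data.List.Relation.Unary.Any.Properties using (cartesianProductWith⁺)
open import Data.Nat using (zero; suc; _+_; _*_)
open import Data.Nat.ListAction using (sum)
open import Data.Nat.ListAction.Properties using (sum-++)
import Data.Nat.Properties as NP
open import Data.Product using (Σ; _,_; proj₁; proj₂; map₁)
import Data.Product as Product
open import Data.Product.Properties using (≡-dec)
open import Data.Rational as Q using (ℚ; 0ℚ; 1ℚ)
import Data.Rational.Properties as QP
import Data.Rational.Unnormalised as U
import Data.Rational.Unnormalised.Properties as UP
import Data.Integer as ℤ
import Data.Integer.Properties as ℤP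
open import Data.Sum using (_⊎_; inj₁; inj₂)
open import Data.Unit using (tt)
open import Function using (_∘_; _⇔_; mk⇔; Equivalence)
open import Relation.Nullary using (yes; no)
open import Relation.Nullary.Decidable using (⌊_⌋; toWitness; fromWitness; ⌊⌋-map′)
open import Relation.Binary.PropositionalEquality
  using (_≡_; _≢_; _≗_; refl; sym; trans; cong; cong₂; subst; ≡-≟-identity; module ≡-Reasoning)
open import Algebra.Bundles using (CommutativeMonoid)
import Algebra.Properties.CommutativeSemigroup as CommutativeSemigroupProperties
open import Algebra.Properties.Group QP.+-0-group using (//-rightDividesʳ)

toℚᵘ-toℚ : ∀ n → Q.toℚᵘ (toℚ n) U.≃ U.mkℚᵘ (ℤ.+ n) 0
toℚᵘ-toℚ n = QP.toℚᵘ-fromℚᵘ (U.mkℚᵘ (ℤ.+ n) 0)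

mkℚᵘ-+ : ∀ m n → U.mkℚᵘ (ℤ.+ (m + n)) 0 U.≃ U.mkℚᵘ (ℤ.+ m) 0 U.+ U.mkℚᵘ (ℤ.+ n) 0
mkℚᵘ-+ m n = U.*≡* (begin
  ℤ.+ (m + n) ℤ.* ℤ.+ 1                            ≡⟨ ℤP.*-identityʳ _ ⟩
  ℤ.+ (m + n)                                      ≡⟨ ℤP.pos-+ m n ⟩
  ℤ.+ m ℤ.+ ℤ.+ n                                  ≡⟨ cong₂ ℤ._+_ (ℤP.*-identityʳ (ℤ.+ m)) (ℤP.*-identityʳ (ℤ.+ n)) ⟨
  ℤ.+ m ℤ.* ℤ.+ 1 ℤ.+ ℤ.+ n ℤ.* ℤ.+ 1              ≡⟨ ℤP.*-identityʳ _ ⟨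
  (ℤ.+ m ℤ.* ℤ.+ 1 ℤ.+ ℤ.+ n ℤ.* ℤ.+ 1) ℤ.* ℤ.+ 1 ∎)
  where open ≡-Reasoning

toℚ-+ : ∀ m n → toℚ (m + n) ≡ toℚ m Q.+ toℚ n
toℚ-+ m n = QP.toℚᵘ-injective (begin
  Q.toℚᵘ (toℚ (m + n))                    ≈⟨ toℚᵘ-toℚ (m + n) ⟩
  U.mkℚᵘ (ℤ.+ (m + n)) 0                  ≈⟨ mkℚᵘ-+ m n ⟩
  U.mkℚᵘ (ℤ.+ m) 0 U.+ U.mkℚᵘ (ℤ.+ n) 0   ≈⟨ UP.+-cong (toℚᵘ-toℚ m) (toℚᵘ-toℚ n) ⟨
  Q.toℚᵘ (toℚ m) U.+ Q.toℚᵘ (toℚ n)       ≈⟨ QP.toℚᵘ-homo-+ (toℚ m) (toℚ n) ⟨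
  Q.toℚᵘ (toℚ m Q.+ toℚ n)                ∎)
  where open UP.≃-Reasoning

T-injective : ∀ {x y} → (T x → T y) → (T y → T x) → x ≡ y
T-injective {false} {false} _ _ = refl
T-injective {false} {true}  _ g = ⊥-elim (g tt)
T-injective {true}  {false} f _ = ⊥-elim (f tt)
T-injective {true}  {true}  _ _ = refl

T-not-∨ : ∀ {x y} → T (not x ∨ y) ⇔ (T x → T y)
T-not-∨ {true}  = mk⇔ (λ ty _ → ty) (λ f → f tt)
T-not-∨ {false} = mk⇔ (λ _ ()) (λ _ → tt)

⌊≟⌋-refl : ∀ {n} (a : Fin n) → ⌊ a ≟ a ⌋ ≡ true
⌊≟⌋-refl a = cong ⌊_⌋ (≡-≟-identity _≟_ refl)

∧-interchange : ∀ a b c d → (a ∧ b) ∧ (c ∧ d) ≡ (a ∧ c) ∧ (b ∧ d)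
∧-interchange = CommutativeSemigroupProperties.interchange (CommutativeMonoid.commutativeSemigroup ∧-commutativeMonoid)

all-cong : ∀ {A : Set} {p q : A → Bool} → p ≗ q → ∀ xs → all p xs ≡ all q xs
all-cong p≗q xs = cong and (LP.map-cong p≗q xs)

all-++ : ∀ {A : Set} (p : A → Bool) xs ys → all p (xs ++ ys) ≡ all p xs ∧ all p ys
all-++ p []       ys = refl
all-++ p (x ∷ xs) ys = trans (cong (p x ∧_) (all-++ p xs ys)) (sym (∧-assoc (p x) _ _))

all-concatMap : ∀ {A B : Set} (p : B → Bool) (g : A → List B) xs →
                all p (concatMap g xs) ≡ all (λ x → all p (g x)) xs
all-concatMap p g []       = refl
all-concatMap p g (x ∷ xs) = trans (all-++ p (g x) (concatMap g xs)) (cong (all p (g x) ∧_) (all-concatMap p g xs))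

all-if : ∀ {A : Set} (p : A → Bool) b x → all p (if b then [ x ] else []) ≡ not b ∨ p x
all-if p true  x = ∧-identityʳ (p x)
all-if p false x = refl

-- Finite sums

+-interchange : ∀ a b c d → (a + b) + (c + d) ≡ (a + c) + (b + d)
+-interchange = CommutativeSemigroupProperties.interchange NP.+-commutativeSemigroup

𝟙 : Bool → ℕ
𝟙 b = if b then 1 else 0

𝟙-∧ : ∀ a b → 𝟙 (a ∧ b) ≡ 𝟙 a * 𝟙 b
𝟙-∧ true  b = sym (NP.+-identityʳ (𝟙 b))
𝟙-∧ false b = refl

𝟙-split : ∀ c b → 𝟙 b ≡ 𝟙 (not c ∧ b) + 𝟙 c * 𝟙 b
𝟙-split false b = sym (NP.+-identityʳ (𝟙 b))
𝟙-split true  b = sym (NP.+-identityʳ (𝟙 b))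

𝟙*-congʳ : ∀ b {x y} → (T b → x ≡ y) → 𝟙 b * x ≡ 𝟙 b * y
𝟙*-congʳ true  x≡y = cong (_+ 0) (x≡y tt)
𝟙*-congʳ false _   = refl

∑ : ∀ {A : Set} → List A → (A → ℕ) → ℕ
∑ xs F = sum (map F xs)

syntax ∑ xs (λ x → e) = ∑[ x ← xs ] e

∑-cong : ∀ {A : Set} (xs : List A) {F G : A → ℕ} → F ≗ G → ∑ xs F ≡ ∑ xs G
∑-cong xs F≗G = cong sum (LP.map-cong F≗G xs)

∑-zero : ∀ {A : Set} (xs : List A) {F : A → ℕ} → (∀ x → F x ≡ 0) → ∑ xs F ≡ 0
∑-zero []       F≡0 = refl
∑-zero (x ∷ xs) F≡0 = cong₂ _+_ (F≡0 x) (∑-zero xs F≡0)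

∑-+ : ∀ {A : Set} (xs : List A) (F G : A → ℕ) → ∑[ x ← xs ] (F x + G x) ≡ ∑ xs F + ∑ xs G
∑-+ []       F G = refl
∑-+ (x ∷ xs) F G = trans (cong (F x + G x +_) (∑-+ xs F G)) (+-interchange (F x) (G x) (∑ xs F) (∑ xs G))

∑-*ʳ : ∀ {A : Set} (xs : List A) (F : A → ℕ) c → ∑[ x ← xs ] (F x * c) ≡ ∑ xs F * c
∑-*ʳ []       F c = refl
∑-*ʳ (x ∷ xs) F c = trans (cong (F x * c +_) (∑-*ʳ xs F c)) (sym (NP.*-distribʳ-+ c (F x) (∑ xs F)))

∑-swap : ∀ {A B : Set} (xs : List A) (ys : List B) (F : A → B → ℕ) →
         ∑[ x ← xs ] ∑ ys (F x) ≡ ∑[ y ← ys ] ∑[ x ← xs ] F x y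
∑-swap []       ys F = sym (∑-zero ys (λ _ → refl))
∑-swap (x ∷ xs) ys F = trans (cong (∑ ys (F x) +_) (∑-swap xs ys F)) (sym (∑-+ ys (F x) _))

∑-map : ∀ {A B : Set} (g : A → B) (xs : List A) (F : B → ℕ) → ∑ (map g xs) F ≡ ∑[ x ← xs ] F (g x)
∑-map g xs F = cong sum (sym (LP.map-∘ xs))

∑-concatMap : ∀ {A B : Set} (g : A → List B) (xs : List A) (F : B → ℕ) →
              ∑ (concatMap g xs) F ≡ ∑[ x ← xs ] ∑ (g x) F
∑-concatMap g []       F = refl
∑-concatMap g (x ∷ xs) F = begin
  sum (map F (g x ++ concatMap g xs))        ≡⟨ cong sum (LP.map-++ F (g x) _) ⟩
  sum (map F (g x) ++ map F (concatMap g xs)) ≡⟨ sum-++ (map F (g x)) _ ⟩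
  ∑ (g x) F + ∑ (concatMap g xs) F          ≡⟨ cong (∑ (g x) F +_) (∑-concatMap g xs F) ⟩
  ∑ (g x) F + ∑[ y ← xs ] ∑ (g y) F         ∎
  where open ≡-Reasoning

∑-allFin-suc : ∀ m (F : Fin (suc m) → ℕ) → ∑ (allFin (suc m)) F ≡ F zero + ∑[ x ← allFin m ] F (suc x)
∑-allFin-suc m F =
  cong (F zero +_) (trans (cong (λ xs → ∑ xs F) (sym (LP.map-tabulate (λ x → x) suc))) (∑-map suc (allFin m) F))

∑-δ : ∀ m (c : Fin m) (A : Fin m → ℕ) → ∑[ x ← allFin m ] (𝟙 ⌊ x ≟ c ⌋ * A x) ≡ A c
∑-δ (suc m) zero A = begin
  ∑[ x ← allFin (suc m) ] (𝟙 ⌊ x ≟ zero ⌋ * A x)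
    ≡⟨ ∑-allFin-suc m _ ⟩
  1 * A zero + ∑[ x ← allFin m ] 0
    ≡⟨ cong₂ _+_ (NP.*-identityˡ (A zero)) (∑-zero (allFin m) (λ _ → refl)) ⟩
  A zero + 0
    ≡⟨ NP.+-identityʳ (A zero) ⟩
  A zero ∎
  where open ≡-Reasoning
∑-δ (suc m) (suc c) A = begin
  ∑[ x ← allFin (suc m) ] (𝟙 ⌊ x ≟ suc c ⌋ * A x)
    ≡⟨ ∑-allFin-suc m (λ x → 𝟙 ⌊ x ≟ suc c ⌋ * A x) ⟩
  ∑[ x ← allFin m ] (𝟙 ⌊ suc x ≟ suc c ⌋ * A (suc x))
    ≡⟨ ∑-cong (allFin m) (λ x → cong (λ b → 𝟙 b * A (suc x)) (⌊⌋-map′ _ _ (x ≟ c))) ⟩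
  ∑[ x ← allFin m ] (𝟙 ⌊ x ≟ c ⌋ * A (suc x))
    ≡⟨ ∑-δ m c (A ∘ suc) ⟩
  A (suc c) ∎
  where open ≡-Reasoning

_≗ᵇ_ : ∀ {n m} → (Fin n → Fin m) → (Fin n → Fin m) → Bool
f ≗ᵇ g = ⌊ all? (λ x → f x ≟ g x) ⌋

≗ᵇ-sound : ∀ {n m} {f g : Fin n → Fin m} → T (f ≗ᵇ g) → f ≗ g
≗ᵇ-sound = toWitness

≗ᵇ-complete : ∀ {n m} {f g : Fin n → Fin m} → f ≗ g → T (f ≗ᵇ g)
≗ᵇ-complete = fromWitness

consF-≗ᵇ : ∀ {n m} x (f : Fin n → Fin m) h → consF x f ≗ᵇ h ≡ ⌊ x ≟ h zero ⌋ ∧ f ≗ᵇ (h ∘ suc)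
consF-≗ᵇ x f h = T-injective to from
  where
  to : T (consF x f ≗ᵇ h) → T (⌊ x ≟ h zero ⌋ ∧ f ≗ᵇ (h ∘ suc))
  to t = Equivalence.from T-∧ (fromWitness (≗ᵇ-sound t zero) , ≗ᵇ-complete (≗ᵇ-sound t ∘ suc))
  from : T (⌊ x ≟ h zero ⌋ ∧ f ≗ᵇ (h ∘ suc)) → T (consF x f ≗ᵇ h)
  from t with Equivalence.to T-∧ t
  ... | x≡h0 , f≗h∘suc = ≗ᵇ-complete λ { zero → toWitness x≡h0 ; (suc y) → ≗ᵇ-sound f≗h∘suc y }

∑-allMaps-suc : ∀ n m (F : (Fin (suc n) → Fin m) → ℕ) →
                ∑ (allMaps (suc n) m) F ≡ ∑[ f ← allMaps n m ] ∑[ x ← allFin m ] F (consF x f)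
∑-allMaps-suc n m F = trans (∑-concatMap _ (allMaps n m) F) (∑-cong (allMaps n m) (λ f → ∑-map _ (allFin m) F))

∑-≗ᵇ : ∀ n m (h : Fin n → Fin m) → ∑[ f ← allMaps n m ] 𝟙 (f ≗ᵇ h) ≡ 1
∑-≗ᵇ zero    m h =
  cong (λ b → 𝟙 b + 0) (T-injective (λ _ → tt) (λ _ → ≗ᵇ-complete {f = λ ()} {h} λ ()))
∑-≗ᵇ (suc n) m h = begin
  ∑[ f ← allMaps (suc n) m ] 𝟙 (f ≗ᵇ h)
    ≡⟨ ∑-allMaps-suc n m (λ f → 𝟙 (f ≗ᵇ h)) ⟩
  ∑[ f ← allMaps n m ] ∑[ x ← allFin m ] 𝟙 (consF x f ≗ᵇ h)
    ≡⟨ ∑-cong (allMaps n m) (λ f → ∑-cong (allFin m) (λ x →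
         trans (cong 𝟙 (consF-≗ᵇ x f h)) (𝟙-∧ ⌊ x ≟ h zero ⌋ (f ≗ᵇ (h ∘ suc))))) ⟩
  ∑[ f ← allMaps n m ] ∑[ x ← allFin m ] (𝟙 ⌊ x ≟ h zero ⌋ * 𝟙 (f ≗ᵇ (h ∘ suc)))
    ≡⟨ ∑-cong (allMaps n m) (λ f → ∑-δ m (h zero) (λ _ → 𝟙 (f ≗ᵇ (h ∘ suc)))) ⟩
  ∑[ f ← allMaps n m ] 𝟙 (f ≗ᵇ (h ∘ suc))
    ≡⟨ ∑-≗ᵇ n m (h ∘ suc) ⟩
  1 ∎
  where open ≡-Reasoning

-- Each g contributes F (ψ g) once, to the summand of the map f = ψ g.
∑-reindex : ∀ {k n m} (ψ : (Fin k → Fin m) → (Fin n → Fin m)) (F : (Fin n → Fin m) → ℕ) →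
            (∀ {f f′} → f ≗ f′ → F f ≡ F f′) →
            ∑[ g ← allMaps k m ] F (ψ g) ≡
            ∑[ f ← allMaps n m ] (∑[ g ← allMaps k m ] 𝟙 (f ≗ᵇ ψ g) * F f)
∑-reindex {k} {n} {m} ψ F F-cong = begin
  ∑[ g ← Gs ] F (ψ g)
    ≡⟨ ∑-cong Gs (λ g → sym (counted-once (ψ g) (F (ψ g)))) ⟩
  ∑[ g ← Gs ] ∑[ f ← Fs ] (𝟙 (f ≗ᵇ ψ g) * F (ψ g))
    ≡⟨ ∑-cong Gs (λ g → ∑-cong Fs (λ f →
         𝟙*-congʳ (f ≗ᵇ ψ g) (λ t → F-cong (λ x → sym (≗ᵇ-sound t x))))) ⟩
  ∑[ g ← Gs ] ∑[ f ← Fs ] (𝟙 (f ≗ᵇ ψ g) * F f)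
    ≡⟨ ∑-swap Gs Fs _ ⟩
  ∑[ f ← Fs ] ∑[ g ← Gs ] (𝟙 (f ≗ᵇ ψ g) * F f)
    ≡⟨ ∑-cong Fs (λ f → ∑-*ʳ Gs (λ g → 𝟙 (f ≗ᵇ ψ g)) (F f)) ⟩
  ∑[ f ← Fs ] (∑[ g ← Gs ] 𝟙 (f ≗ᵇ ψ g) * F f) ∎
  where
  open ≡-Reasoning
  Gs = allMaps k m
  Fs = allMaps n m
  counted-once : ∀ h c → ∑[ f ← Fs ] (𝟙 (f ≗ᵇ h) * c) ≡ c
  counted-once h c = trans (∑-*ʳ Fs _ c) (trans (cong (_* c) (∑-≗ᵇ n m h)) (NP.*-identityˡ c))

-- Counting maps under edge and separation constraints

Pairs : ℕ → Set
Pairs n = List (Fin n × Fin n)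

respects : ∀ {n m} → (Fin m → Fin m → Bool) → (Fin n → Fin m) → Pairs n → Bool
respects R f = all (λ p → R (f (proj₁ p)) (f (proj₂ p)))

distinct : ∀ {m} → Fin m → Fin m → Bool
distinct u v = not ⌊ u ≟ v ⌋

count : (H : Graph) → ∀ {n} → Pairs n → Pairs n → ℕ
count H {n} E D = ∑[ f ← allMaps n (size H) ] 𝟙 (respects distinct f D ∧ respects (adj H) f E)

T-respects : ∀ {n m} {R : Fin m → Fin m → Bool} {f : Fin n → Fin m} {P} →
             T (respects R f P) ⇔ (∀ {a b} → (a , b) ∈ P → T (R (f a) (f b)))
T-respects {R = R} {f} {P} = mk⇔
  (λ t {_} {_} → All.lookup (all⁺ r P t))
  (λ h → all⁻ r {xs = P} (All.tabulate λ {p} → h {proj₁ p} {proj₂ p}))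
  where
  r : _ → Bool
  r p = R (f (proj₁ p)) (f (proj₂ p))

respects-cong : ∀ {n m} (R : Fin m → Fin m → Bool) {f f′ : Fin n → Fin m} → f ≗ f′ → ∀ P →
                respects R f P ≡ respects R f′ P
respects-cong R f≗f′ = all-cong (λ p → cong₂ R (f≗f′ (proj₁ p)) (f≗f′ (proj₂ p)))

respects-∘ : ∀ {k n m} (R : Fin m → Fin m → Bool) (g : Fin n → Fin m) (ρ : Fin k → Fin n) P →
             respects R (g ∘ ρ) P ≡ respects R g (map (Product.map ρ ρ) P)
respects-∘ R g ρ P = cong and (LP.map-∘ P)

respects-∧ : ∀ {n m} (R S : Fin m → Fin m → Bool) (f : Fin n → Fin m) P →
             respects (λ u v → R u v ∧ S u v) f P ≡ respects R f P ∧ respects S f P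
respects-∧ R S f []      = refl
respects-∧ R S f (p ∷ P) =
  trans (cong ((Rp ∧ Sp) ∧_) (respects-∧ R S f P)) (∧-interchange Rp Sp (respects R f P) (respects S f P))
  where
  Rp = R (f (proj₁ p)) (f (proj₂ p))
  Sp = S (f (proj₁ p)) (f (proj₂ p))

count-diagonal : ∀ H {n} (E D : Pairs n) i → count H E ((i , i) ∷ D) ≡ 0
count-diagonal H {n} E D i =
  ∑-zero (allMaps n (size H)) λ f →
    cong (λ b → 𝟙 ((not b ∧ respects distinct f D) ∧ respects (adj H) f E)) (⌊≟⌋-refl (f i))

-- Identifying two vertices

-- ρ merges j into i; ι is a section of ρ.
module Contraction {n} (i j : Fin (suc n)) (i≢j : i ≢ j) where

  ρ : Fin (suc n) → Fin n
  ρ x with x ≟ j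
  ... | yes _   = punchOut (i≢j ∘ sym)
  ... | no x≢j = punchOut (x≢j ∘ sym)

  ι : Fin n → Fin (suc n)
  ι = punchIn j

  ρ-ι : ∀ u → ρ (ι u) ≡ u
  ρ-ι u with punchIn j u ≟ j
  ... | yes ιu≡j = ⊥-elim (punchInᵢ≢i j u ιu≡j)
  ... | no _     = trans (punchOut-cong j refl) (punchOut-punchIn j)

  ι-ρ : ∀ {A : Set} (f : Fin (suc n) → A) → f i ≡ f j → ∀ x → f (ι (ρ x)) ≡ f x
  ι-ρ f fi≡fj x with x ≟ j
  ... | yes refl = trans (cong f (punchIn-punchOut _)) fi≡fj
  ... | no _     = cong f (punchIn-punchOut _)

  ρi≡ρj : ρ i ≡ ρ j
  ρi≡ρj with i ≟ j | j ≟ j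
  ... | yes i≡j | _       = ⊥-elim (i≢j i≡j)
  ... | no _    | yes _   = punchOut-cong j refl
  ... | no _    | no j≢j = ⊥-elim (j≢j refl)

  -- A map f factors through ρ iff f i ≡ f j, and then uniquely, as (f ∘ ι) ∘ ρ.
  fibre : ∀ {m} (f : Fin (suc n) → Fin m) →
          ∑[ g ← allMaps n m ] 𝟙 (f ≗ᵇ (g ∘ ρ)) ≡ 𝟙 ⌊ f i ≟ f j ⌋
  fibre {m} f with f i ≟ f j
  ... | yes fi≡fj =
    trans (∑-cong (allMaps n m) (λ g → cong 𝟙 (T-injective (to g) (from g)))) (∑-≗ᵇ n m (f ∘ ι))
    where
    to : ∀ g → T (f ≗ᵇ (g ∘ ρ)) → T (g ≗ᵇ (f ∘ ι))
    to g t = ≗ᵇ-complete (λ u → trans (cong g (sym (ρ-ι u))) (sym (≗ᵇ-sound t (ι u))))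
    from : ∀ g → T (g ≗ᵇ (f ∘ ι)) → T (f ≗ᵇ (g ∘ ρ))
    from g t = ≗ᵇ-complete (λ x → trans (sym (ι-ρ f fi≡fj x)) (sym (≗ᵇ-sound t (ρ x))))
  ... | no fi≢fj = ∑-zero (allMaps n m) (λ g → cong 𝟙 (T-injective (λ t → fi≢fj (identifies g t)) λ ()))
    where
    identifies : ∀ g → T (f ≗ᵇ (g ∘ ρ)) → f i ≡ f j
    identifies g t = trans (≗ᵇ-sound t i) (trans (cong g ρi≡ρj) (sym (≗ᵇ-sound t j)))

  ∑-identified : ∀ {m} (F : (Fin (suc n) → Fin m) → ℕ) → (∀ {f f′} → f ≗ f′ → F f ≡ F f′) →
                 ∑[ f ← allMaps (suc n) m ] (𝟙 ⌊ f i ≟ f j ⌋ * F f) ≡ ∑[ g ← allMaps n m ] F (g ∘ ρ)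
  ∑-identified F F-cong =
    sym (trans (∑-reindex (_∘ ρ) F F-cong) (∑-cong (allMaps (suc _) _) (λ f → cong (_* F f) (fibre f))))

  contract : Pairs (suc n) → Pairs n
  contract = map (Product.map ρ ρ)

  count-deletion-contraction : ∀ H (E D : Pairs (suc n)) →
                               count H E D ≡ count H E ((i , j) ∷ D) + count H (contract E) (contract D)
  count-deletion-contraction H E D = begin
    count H E D
      ≡⟨ ∑-cong Fs (λ f → 𝟙-split ⌊ f i ≟ f j ⌋ (c f)) ⟩
    ∑[ f ← Fs ] (𝟙 (not ⌊ f i ≟ f j ⌋ ∧ c f) + 𝟙 ⌊ f i ≟ f j ⌋ * 𝟙 (c f))
      ≡⟨ ∑-+ Fs _ _ ⟩
    ∑[ f ← Fs ] 𝟙 (not ⌊ f i ≟ f j ⌋ ∧ c f) + ∑[ f ← Fs ] (𝟙 ⌊ f i ≟ f j ⌋ * 𝟙 (c f))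
      ≡⟨ cong₂ _+_ (∑-cong Fs (λ f → cong 𝟙 (sym (∧-assoc _ (respects distinct f D) (respects (adj H) f E)))))
                   (∑-identified (𝟙 ∘ c) c-cong) ⟩
    count H E ((i , j) ∷ D) + ∑[ g ← allMaps n (size H) ] 𝟙 (c (g ∘ ρ))
      ≡⟨ cong (count H E ((i , j) ∷ D) +_) (∑-cong (allMaps n (size H)) (λ g →
           cong 𝟙 (cong₂ _∧_ (respects-∘ distinct g ρ D) (respects-∘ (adj H) g ρ E)))) ⟩
    count H E ((i , j) ∷ D) + count H (contract E) (contract D) ∎
    where
    open ≡-Reasoning
    Fs = allMaps (suc n) (size H)
    c : (Fin (suc n) → Fin (size H)) → Bool
    c f = respects distinct f D ∧ respects (adj H) f E
    c-cong : ∀ {f f′} → f ≗ f′ → 𝟙 (c f) ≡ 𝟙 (c f′)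
    c-cong f≗f′ = cong 𝟙 (cong₂ _∧_ (respects-cong distinct f≗f′ D) (respects-cong (adj H) f≗f′ E))

-- Homomorphisms as constrained maps

T-isHom : ∀ {G H f} → T (isHom G H f) ⇔ (∀ i j → T (adj G i j) → T (adj H (f i) (f j)))
T-isHom {G} {H} {f} = mk⇔ to from
  where
  entry : Fin (size G) → Fin (size G) → Bool
  entry i j = not (adj G i j) ∨ adj H (f i) (f j)
  row : Fin (size G) → Bool
  row i = all (entry i) (allFin (size G))
  to : T (isHom G H f) → ∀ i j → T (adj G i j) → T (adj H (f i) (f j))
  to t i j =
    Equivalence.to T-not-∨ (All.lookup (all⁺ (entry i) _ (All.lookup (all⁺ row _ t) (∈-allFin i))) (∈-allFin j))
  from : (∀ i j → T (adj G i j) → T (adj H (f i) (f j))) → T (isHom G H f)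
  from h = all⁻ row {xs = allFin (size G)} (All.tabulate λ {i} _ →
             all⁻ (entry i) {xs = allFin (size G)} (All.tabulate λ {j} _ → Equivalence.from T-not-∨ (h i j)))

graphOf : ∀ {n} → Pairs n → Graph
graphOf {n} E = record
  { size    = n
  ; adj     = λ u v → ⌊ (u , v) ∈? E ⌋ ∨ ⌊ (v , u) ∈? E ⌋
  ; adj-sym = λ u v → ∨-comm ⌊ (u , v) ∈? E ⌋ ⌊ (v , u) ∈? E ⌋
  }
  where open DecMembership (≡-dec _≟_ _≟_)

isHom-graphOf : ∀ {n} (E : Pairs n) H f → isHom (graphOf E) H f ≡ respects (adj H) f E
isHom-graphOf E H f = T-injective to from
  where
  open DecMembership (≡-dec _≟_ _≟_) using (_∈?_)
  isHom⇔ = T-isHom {graphOf E} {H} {f}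
  respects⇔ = T-respects {R = adj H} {f} {E}
  to : T (isHom (graphOf E) H f) → T (respects (adj H) f E)
  to t = Equivalence.from respects⇔ λ {a} {b} ab∈E →
    Equivalence.to isHom⇔ t a b (Equivalence.from (T-∨ {⌊ (a , b) ∈? E ⌋}) (inj₁ (fromWitness ab∈E)))
  edge : T (respects (adj H) f E) → ∀ i j →
         T ⌊ (i , j) ∈? E ⌋ ⊎ T ⌊ (j , i) ∈? E ⌋ → T (adj H (f i) (f j))
  edge r i j (inj₁ ij∈E) = Equivalence.to respects⇔ r (toWitness ij∈E)
  edge r i j (inj₂ ji∈E) = subst T (adj-sym H (f j) (f i)) (Equivalence.to respects⇔ r (toWitness ji∈E))
  from : T (respects (adj H) f E) → T (isHom (graphOf E) H f)
  from r = Equivalence.from isHom⇔ λ i j e → edge r i j (Equivalence.to T-∨ e)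

edges : (G : Graph) → Pairs (size G)
edges G = concatMap (λ i → concatMap (λ j → if adj G i j then [ (i , j) ] else []) (allFin (size G))) (allFin (size G))

isHom-edges : ∀ G H f → isHom G H f ≡ respects (adj H) f (edges G)
isHom-edges G H f = sym (begin
  all r (edges G)
    ≡⟨ all-concatMap r _ (allFin (size G)) ⟩
  all (λ i → all r (concatMap (λ j → if adj G i j then [ (i , j) ] else []) (allFin (size G)))) (allFin (size G))
    ≡⟨ all-cong (λ i → trans (all-concatMap r _ (allFin (size G)))
                             (all-cong (λ j → all-if r (adj G i j) (i , j)) (allFin (size G))))
                (allFin (size G)) ⟩
  isHom G H f ∎)
  where
  open ≡-Reasoning
  r : Fin (size G) × Fin (size G) → Bool
  r p = adj H (f (proj₁ p)) (f (proj₂ p))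

count-[] : ∀ H {n} (E : Pairs n) → count H E [] ≡ hom (graphOf E) H
count-[] H {n} E = ∑-cong (allMaps n (size H)) (λ f → cong 𝟙 (sym (isHom-graphOf E H f)))

hom-removeLoops : ∀ G H → hom G (removeLoops H) ≡ count H (edges G) (edges G)
hom-removeLoops G H = ∑-cong (allMaps (size G) (size H)) λ f → cong 𝟙 (begin
  isHom G (removeLoops H) f
    ≡⟨ isHom-edges G (removeLoops H) f ⟩
  respects (λ u v → adj H u v ∧ distinct u v) f (edges G)
    ≡⟨ respects-∧ (adj H) distinct f (edges G) ⟩
  respects (adj H) f (edges G) ∧ respects distinct f (edges G)
    ≡⟨ ∧-comm (respects (adj H) f (edges G)) _ ⟩
  respects distinct f (edges G) ∧ respects (adj H) f (edges G) ∎)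
  where open ≡-Reasoning

Combination : Set
Combination = List (ℚ × Graph)

homSum : Combination → Graph → ℚ
homSum []            H = 0ℚ
homSum ((c , F) ∷ L) H = c Q.* toℚ (hom F H) Q.+ homSum L H

negate : Combination → Combination
negate = map (map₁ (Q.-_))

homSum-++ : ∀ L M H → homSum (L ++ M) H ≡ homSum L H Q.+ homSum M H
homSum-++ []            M H = sym (QP.+-identityˡ (homSum M H))
homSum-++ ((c , F) ∷ L) M H =
  trans (cong (c Q.* toℚ (hom F H) Q.+_) (homSum-++ L M H))
        (sym (QP.+-assoc (c Q.* toℚ (hom F H)) (homSum L H) (homSum M H)))

homSum-negate : ∀ L H → homSum (negate L) H ≡ Q.- homSum L H
homSum-negate []            H = refl
homSum-negate ((c , F) ∷ L) H =
  trans (cong₂ Q._+_ (sym (QP.neg-distribˡ-* c (toℚ (hom F H)))) (homSum-negate L H))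
        (sym (QP.neg-distrib-+ (c Q.* toℚ (hom F H)) (homSum L H)))

HomLinear : (Graph → ℕ) → Set
HomLinear φ = Σ Combination λ L → ∀ H → toℚ (φ H) ≡ homSum L H

hom-linear : ∀ F → HomLinear (hom F)
hom-linear F = [ (1ℚ , F) ] , λ H → sym (trans (QP.+-identityʳ _) (QP.*-identityˡ (toℚ (hom F H))))

HomLinear-cong : ∀ {φ ψ} → (∀ H → φ H ≡ ψ H) → HomLinear φ → HomLinear ψ
HomLinear-cong φ≡ψ (L , φ≡L) = L , λ H → trans (cong toℚ (sym (φ≡ψ H))) (φ≡L H)

HomLinear-difference : ∀ {φ ψ χ} → (∀ H → φ H ≡ ψ H + χ H) → HomLinear φ → HomLinear χ → HomLinear ψ
HomLinear-difference {φ} {ψ} {χ} φ≡ψ+χ (L , φ≡L) (M , χ≡M) = L ++ negate M , λ H → begin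
  toℚ (ψ H)                              ≡⟨ //-rightDividesʳ (toℚ (χ H)) (toℚ (ψ H)) ⟨
  toℚ (ψ H) Q.+ toℚ (χ H) Q.- toℚ (χ H)  ≡⟨ cong (Q._- toℚ (χ H)) (toℚ-+ (ψ H) (χ H)) ⟨
  toℚ (ψ H + χ H) Q.- toℚ (χ H)          ≡⟨ cong (λ x → toℚ x Q.- toℚ (χ H)) (φ≡ψ+χ H) ⟨
  toℚ (φ H) Q.- toℚ (χ H)                ≡⟨ cong₂ Q._-_ (φ≡L H) (χ≡M H) ⟩
  homSum L H Q.- homSum M H              ≡⟨ cong (homSum L H Q.+_) (homSum-negate M H) ⟨
  homSum L H Q.+ homSum (negate M) H     ≡⟨ homSum-++ L (negate M) H ⟨
  homSum (L ++ negate M) H               ∎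
  where open ≡-Reasoning

-- Induction on the number k of separation constraints, which contraction preserves.
count-linear : ∀ k {n} (E D : Pairs n) → length D ≡ k → HomLinear (λ H → count H E D)
count-linear k E [] _ = HomLinear-cong {ψ = λ H → count H E []} (λ H → sym (count-[] H E)) (hom-linear (graphOf E))
count-linear zero E (_ ∷ _) ()
count-linear (suc k) {zero}  E ((() , _) ∷ D) _
count-linear (suc k) {suc n} E ((i , j) ∷ D) |D|≡k with i ≟ j
... | yes refl = [] , λ H → cong toℚ (count-diagonal H E D i)
... | no i≢j   = HomLinear-difference {ψ = λ H → count H E ((i , j) ∷ D)} (λ H → count-deletion-contraction H E D)
                   (count-linear k E D (NP.suc-injective |D|≡k))
                   (count-linear k (contract E) (contract D) (trans (LP.length-map _ D) (NP.suc-injective |D|≡k)))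
  where open Contraction i j i≢j

hom-removeLoops-linear : ∀ G → HomLinear (λ H → hom G (removeLoops H))
hom-removeLoops-linear G =
  HomLinear-cong {ψ = λ H → hom G (removeLoops H)} (λ H → sym (hom-removeLoops G H))
                 (count-linear _ (edges G) (edges G) refl)

-- Polynomial sequences

scale : ∀ {h} → ℚ → Poly h → Poly h
scale c = map (map₁ (c Q.*_))

eval-scale : ∀ {h} c (p : Poly h) k → eval (scale c p) k ≡ c Q.* eval p k
eval-scale c []            k = sym (QP.*-zeroʳ c)
eval-scale c ((d , e) ∷ p) k =
  trans (cong₂ Q._+_ (QP.*-assoc c d (toℚ (monomial e k))) (eval-scale c p k))
        (sym (QP.*-distribˡ-+ c (d Q.* toℚ (monomial e k)) (eval p k)))

eval-++ : ∀ {h} (p q : Poly h) k → eval (p ++ q) k ≡ eval p k Q.+ eval q k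
eval-++ []            q k = sym (QP.+-identityˡ (eval q k))
eval-++ ((d , e) ∷ p) q k =
  trans (cong (d Q.* toℚ (monomial e k) Q.+_) (eval-++ p q k))
        (sym (QP.+-assoc (d Q.* toℚ (monomial e k)) (eval p k) (eval q k)))

homSum-∷-eval : ∀ {h} H c F L (p q : Poly h) k → toℚ (hom F H) ≡ eval p k → homSum L H ≡ eval q k →
                homSum ((c , F) ∷ L) H ≡ eval (scale c p ++ q) k
homSum-∷-eval H c F L p q k F≡p L≡q = begin
  c Q.* toℚ (hom F H) Q.+ homSum L H   ≡⟨ cong₂ (λ x y → c Q.* x Q.+ y) F≡p L≡q ⟩
  c Q.* eval p k Q.+ eval q k          ≡⟨ cong (Q._+ eval q k) (eval-scale c p k) ⟨
  eval (scale c p) k Q.+ eval q k      ≡⟨ eval-++ (scale c p) q k ⟨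
  eval (scale c p ++ q) k              ∎
  where open ≡-Reasoning

homSum-stronglyPolynomial : ∀ {h} {Hs : Sequence h} → IsStronglyPolynomial Hs → ∀ L →
                            Σ (Poly h) λ p → ∀ k → Positive k → homSum L (Hs k) ≡ eval p k
homSum-stronglyPolynomial SP [] = [] , λ _ _ → refl
homSum-stronglyPolynomial {Hs = Hs} SP ((c , F) ∷ L) =
  let (p , F≡p) = SP F
      (q , L≡q) = homSum-stronglyPolynomial SP L
  in scale c p ++ q , λ k k>0 → homSum-∷-eval (Hs k) c F L p q k (F≡p k k>0) (L≡q k k>0)

homSum-polynomial : ∀ {h} {Hs : Sequence h} → IsPolynomial Hs → ∀ L →
                    Σ (List (Poly h)) λ ps → ∀ k → Positive k → Any (λ p → homSum L (Hs k) ≡ eval p k) ps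
homSum-polynomial P [] = [ [] ] , λ _ _ → here refl
homSum-polynomial {Hs = Hs} P ((c , F) ∷ L) =
  let (ps , F∈ps) = P F
      (qs , L∈qs) = homSum-polynomial P L
  in cartesianProductWith (λ p q → scale c p ++ q) ps qs ,
     λ k k>0 → cartesianProductWith⁺ _ (λ {p} {q} → homSum-∷-eval (Hs k) c F L p q k) (F∈ps k k>0) (L∈qs k k>0)

corollary3p1 : (h : ℕ) (H : Sequence h) →
    (∀ k → Positive k → AllLooped (H k)) →
    (IsPolynomial H → IsPolynomial (λ k → removeLoops (H k))) ×
    (IsStronglyPolynomial H → IsStronglyPolynomial (λ k → removeLoops (H k)))
corollary3p1 h Hs _ = polynomial , stronglyPolynomial
  where
  polynomial : IsPolynomial Hs → IsPolynomial (λ k → removeLoops (Hs k))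
  polynomial P G =
    let (L , G≡L)   = hom-removeLoops-linear G
        (ps , L∈ps) = homSum-polynomial P L
    in ps , λ k k>0 → AnyMap (trans (G≡L (Hs k))) (L∈ps k k>0)
  stronglyPolynomial : IsStronglyPolynomial Hs → IsStronglyPolynomial (λ k → removeLoops (Hs k))
  stronglyPolynomial SP G =
    let (L , G≡L) = hom-removeLoops-linear G
        (p , L≡p) = homSum-stronglyPolynomial SP L
    in p , λ k k>0 → trans (G≡L (Hs k)) (L≡p k k>0)
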